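{- Let $R$ be a finite group, let $Q$ be a non-normal subgroup of $R$, and let $\mathcal{L}$ be the set of inverse-closed subsets $S\subseteq R$ such that $S$ intersects $QxQ$ evenly for every double coset $QxQ$ ($x\in R$). Then $|\mathcal{L}|\leq 2^{\mathbf{c}(R)-\frac{1}{8}|R:Q|}$.
   Context: For a subset $X$ of a group, $\mathcal{I}(X)$ denotes the set of elements of $X$ of order at most $2$ (including the identity if present), and $\mathbf{c}(X)=(|X|+|\mathcal{I}(X)|)/2$. A subset $S$ is inverse-closed if $S=S^{ -1}$. If $\Delta\subseteq R$ is a union of right $Q$-cosets $\Lambda_1,\dots,\Lambda_b$, then $S\subseteq R$ intersects $\Delta$ evenly if $|S\cap\Lambda_1|=\dots=|S\cap\Lambda_b|$. (Each double coset $QxQ$ is a union of right $Q$-cosets.) -}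

module Defs where

open import Data.Nat using (ℕ; _≤_; _<_; z≤n; NonZero; >-nonZero; _/_)
open import Data.Nat.Properties using (≤-<-trans)
open import Data.Fin using (Fin)
open import Data.Fin.Subset using (Subset; _∈_; _∉_; ∣_∣; _∩_; _-_)
open import Data.Fin.Subset.Properties using (x∈p⇒∣p-x∣<∣p∣)
open import Data.Fin.Properties using (_≟_)
open import Data.Vec using (lookup; tabulate)
open import Data.Product using (Σ; _×_; _,_)
open import Relation.Nullary using (¬_; does)
open import Relation.Binary.PropositionalEquality using (_≡_)
open import Algebra.Structures using (IsGroup)

-- A finite group of order n, realised on the carrier Fin n
-- (every finite group is isomorphic to one of these).
record FiniteGroup (n : ℕ) : Set where
  infixl 7 _∙_
  field
    _∙_     : Fin n → Fin n → Fin n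
    ε       : Fin n
    _⁻¹     : Fin n → Fin n
    isGroup : IsGroup _≡_ _∙_ ε _⁻¹

module _ {n : ℕ} (G : FiniteGroup n) where
  open FiniteGroup G

  record IsSubgroup (Q : Subset n) : Set where
    field
      ε∈      : ε ∈ Q
      ∙-closed : ∀ {a b} → a ∈ Q → b ∈ Q → a ∙ b ∈ Q
      ⁻¹-closed : ∀ {a} → a ∈ Q → a ⁻¹ ∈ Q

  IsNormal : Subset n → Set
  IsNormal Q = ∀ g h → h ∈ Q → g ∙ h ∙ g ⁻¹ ∈ Q

  subgroup-nonZero : ∀ {Q} → IsSubgroup Q → NonZero ∣ Q ∣
  subgroup-nonZero {Q} sg =
    >-nonZero (≤-<-trans z≤n (x∈p⇒∣p-x∣<∣p∣ (IsSubgroup.ε∈ sg)))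

  index : (Q : Subset n) → IsSubgroup Q → ℕ
  index Q sg = _/_ n ∣ Q ∣ {{subgroup-nonZero sg}}

  involutionsAndId : Subset n
  involutionsAndId = tabulate (λ x → does (x ∙ x ≟ ε))

  -- the right coset Q y = { q ∙ y : q ∈ Q } = { g : g ∙ y⁻¹ ∈ Q }
  rightCoset : Subset n → Fin n → Subset n
  rightCoset Q y = tabulate (λ g → lookup Q (g ∙ y ⁻¹))

  InDoubleCoset : Subset n → Fin n → Fin n → Set
  InDoubleCoset Q x y = Σ (Fin n) λ q → Σ (Fin n) λ q' →
    q ∈ Q × q' ∈ Q × y ≡ q ∙ x ∙ q'

  InverseClosed : Subset n → Set
  InverseClosed S = ∀ g → (g ∈ S → g ⁻¹ ∈ S) × (g ⁻¹ ∈ S → g ∈ S)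

  IntersectsEvenly : Subset n → Subset n → Fin n → Set
  IntersectsEvenly Q S x = ∀ y z → InDoubleCoset Q x y → InDoubleCoset Q x z →
    ∣ S ∩ rightCoset Q y ∣ ≡ ∣ S ∩ rightCoset Q z ∣

  InL : Subset n → Subset n → Set
  InL Q S = InverseClosed S × (∀ x → IntersectsEvenly Q S x)

{-# OPTIONS --safe #-}
module Submission where

-- Choose one representative from each inversion orbit {g, g⁻¹}; the set P of representatives has
-- 2|P| ≤ |R| + |I(R)|, and an inverse-closed set S is determined by S ∩ P. A gadget is a pair of
-- cosets Q a, Q b ⊆ Q a Q with some t ∈ Q a such that t, t⁻¹ ∉ Q b: toggling the orbit {t, t⁻¹}
-- changes |S ∩ Q a| but not |S ∩ Q b|, so for S ∈ 𝓛 the toggled set is no longer in 𝓛. Given k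
-- gadgets whose toggles never touch the cosets of earlier gadgets, the 2ᵏ toggle patterns applied
-- to the members of 𝓛 give |𝓛| 2ᵏ distinct sets of the form S′ ∩ P, so |𝓛| 2ᵏ ≤ 2^|P|. Finally,
-- Q is not normal, so its normaliser has at most |R|/2 elements; any x outside it and outside the
-- 4|Q| elements of Q a ∪ Q b and their inverses for each earlier gadget yields a new gadget, so
-- greedily one finds k ≥ |R : Q|/8.

open import Data.Bool using (Bool; true; false; _∧_; _xor_; not)
open import Data.Bool.Properties using (∧-zeroʳ; ∧-identityʳ; ⇔→≡; xor-assoc; xor-same; xor-identityʳ; xor-comm)
open import Data.Fin using (Fin; zero; suc) renaming (_≤_ to _≤ᶠ_)
import Data.Fin.Properties as Fin
import Data.Fin.Subset.Properties as Subset
open import Data.Fin.Subset using (Subset; ∣_∣; ⊤; _⊆_; _⊂_; _∩_) renaming (_∈_ to _∈ₛ_; _∉_ to _∉ₛ_)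
open import Data.Fin.Subset.Properties using (drop-∷-⊆; ∣⊤∣≡n)
open import Data.List using (List; []; _∷_; length; map; _++_; cartesianProduct; allFin)
open import Data.List.Properties using (length-map; length-++; length-tabulate)
open import Data.List.Membership.Propositional using (_∈_; _∉_)
open import Data.List.Membership.Propositional.Properties
  using (∈-map⁺; ∈-map⁻; ∈-++⁺ˡ; ∈-++⁺ʳ; ∈-cartesianProduct⁻; ∈-allFin)
open import Data.List.Relation.Unary.All using (All; []; _∷_)
import Data.List.Relation.Unary.All as All
import Data.List.Relation.Unary.All.Properties as All
open import Data.List.Relation.Unary.AllPairs using (AllPairs; []; _∷_)
import Data.List.Relation.Unary.AllPairs.Properties as AllPairs
open import Data.List.Relation.Unary.Any using (here; there)
import Data.List.Relation.Unary.Any as Any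
open import Data.List.Relation.Unary.Unique.Propositional using (Unique)
import Data.List.Relation.Unary.Unique.Propositional.Properties as Unique
open import Data.Nat using (ℕ; zero; suc; _+_; _*_; _^_; _≤_; z≤n; s≤s; _/_)
open import Data.Nat.Properties using (+-identityʳ; 1+n≰n)
import Data.Nat.Properties as ℕ
import Data.Nat.DivMod as DivMod
open import Data.Product using (Σ; _×_; _,_; proj₁; proj₂; uncurry)
open import Data.Sum using (_⊎_; inj₁; inj₂; [_,_]′)
open import Data.Vec using (Vec; []; _∷_; here; there; lookup; tabulate)
open import Data.Vec.Properties
  using (∷-injectiveʳ; lookup∘tabulate; tabulate∘lookup; tabulate-cong; []=⇒lookup; lookup⇒[]=; lookup-zipWith)
open import Data.Empty using (⊥; ⊥-elim)
open import Function using (_∘_; id)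
open import Function.Bundles using (mk⇔)
open import Relation.Nullary using (¬_; Dec; yes; no; does)
open import Relation.Nullary.Decidable using (dec-true; dec-false; does-⇔; _→-dec_; _⊎-dec_; _×-dec_)
open import Relation.Binary.Definitions using (DecidableEquality)
open import Relation.Binary.PropositionalEquality
import Data.List.Membership.DecPropositional as DecMembership
open import Algebra.Bundles using (Group; Monoid)
open import Algebra.Structures using (IsGroup)
import Algebra.Properties.Group as GroupProperties
open import Tactic.MonoidSolver using (solve)
open import Data.Nat.Tactic.RingSolver using (solve-∀)
open import Defs

m≤a+b∧a+a≤m⇒m≤b+b : ∀ {m a b} → m ≤ a + b → a + a ≤ m → m ≤ b + b
m≤a+b∧a+a≤m⇒m≤b+b {m} {a} {b} m≤a+b a+a≤m = ℕ.+-cancelˡ-≤ m m (b + b) (begin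
  m + m              ≤⟨ ℕ.+-mono-≤ m≤a+b m≤a+b ⟩
  (a + b) + (a + b)  ≡⟨ rearrange a b ⟩
  (a + a) + (b + b)  ≤⟨ ℕ.+-monoˡ-≤ (b + b) a+a≤m ⟩
  m + (b + b)        ∎)
  where
  open ℕ.≤-Reasoning
  rearrange : ∀ a b → (a + b) + (a + b) ≡ (a + a) + (b + b)
  rearrange = solve-∀

^-distribʳ-* : ∀ a b c → (a * b) ^ c ≡ a ^ c * b ^ c
^-distribʳ-* a b zero    = refl
^-distribʳ-* a b (suc c) = trans (cong (a * b *_) (^-distribʳ-* a b c)) (interchange a b (a ^ c) (b ^ c))
  where
  interchange : ∀ a b c d → (a * b) * (c * d) ≡ (a * c) * (b * d)
  interchange = solve-∀

power-bound : ∀ L k {i p m} → i ≤ k * 8 → L * 2 ^ k ≤ 2 ^ p → p + p ≤ m → L ^ 8 * 2 ^ i ≤ 2 ^ (4 * m)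
power-bound L k {i} {p} {m} i≤8k L2ᵏ≤2ᵖ 2p≤m = begin
  L ^ 8 * 2 ^ i        ≤⟨ ℕ.*-monoʳ-≤ (L ^ 8) (ℕ.^-monoʳ-≤ 2 i≤8k) ⟩
  L ^ 8 * 2 ^ (k * 8)  ≡⟨ cong (L ^ 8 *_) (ℕ.^-*-assoc 2 k 8) ⟨
  L ^ 8 * (2 ^ k) ^ 8  ≡⟨ ^-distribʳ-* L (2 ^ k) 8 ⟨
  (L * 2 ^ k) ^ 8      ≤⟨ ℕ.^-monoˡ-≤ 8 L2ᵏ≤2ᵖ ⟩
  (2 ^ p) ^ 8          ≡⟨ ℕ.^-*-assoc 2 p 8 ⟩
  2 ^ (p * 8)          ≤⟨ ℕ.^-monoʳ-≤ 2 (subst (_≤ 4 * m) (eight-halves p) (ℕ.*-monoʳ-≤ 4 2p≤m)) ⟩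
  2 ^ (4 * m)          ∎
  where
  open ℕ.≤-Reasoning
  eight-halves : ∀ p → 4 * (p + p) ≡ p * 8
  eight-halves = solve-∀

module _ {a} {A : Set a} where

  remove : ∀ {x} (xs : List A) → x ∈ xs → List A
  remove (_ ∷ xs) (here _)  = xs
  remove (y ∷ xs) (there p) = y ∷ remove xs p

  length-remove : ∀ {x} xs (p : x ∈ xs) → suc (length (remove xs p)) ≡ length xs
  length-remove (_ ∷ _)  (here _)  = refl
  length-remove (_ ∷ xs) (there p) = cong suc (length-remove xs p)

  ∈-remove : ∀ {x z} xs (p : x ∈ xs) → z ∈ xs → z ≢ x → z ∈ remove xs p
  ∈-remove (_ ∷ _)  (here refl) (here refl) z≢x = ⊥-elim (z≢x refl)
  ∈-remove (_ ∷ _)  (here refl) (there z∈)  _   = z∈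
  ∈-remove (_ ∷ _)  (there p)   (here z≡y)  _   = here z≡y
  ∈-remove (_ ∷ xs) (there p)   (there z∈)  z≢x = there (∈-remove xs p z∈ z≢x)

  unique⇒length≤ : ∀ {xs ys : List A} → Unique xs → All (_∈ ys) xs → length xs ≤ length ys
  unique⇒length≤ {[]}     _              _            = z≤n
  unique⇒length≤ {x ∷ xs} {ys} (x∉ ∷ uniq) (x∈ys ∷ xs⊆ys) =
    subst (suc (length xs) ≤_) (length-remove ys x∈ys)
      (s≤s (unique⇒length≤ uniq (All.zipWith (λ (x≢z , z∈ys) → ∈-remove ys x∈ys z∈ys (x≢z ∘ sym)) (x∉ , xs⊆ys))))

module _ {a b} {A : Set a} {B : Set b} (f : A → B) where

  InjectiveOn : List A → Set _
  InjectiveOn xs = ∀ {x y} → x ∈ xs → y ∈ xs → f x ≡ f y → x ≡ y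

  map⁺-injectiveOn : ∀ {xs} → Unique xs → InjectiveOn xs → Unique (map f xs)
  map⁺-injectiveOn {[]}     _            _   = []
  map⁺-injectiveOn {x ∷ xs} (x∉ ∷ uniq) inj =
    All.map⁺ (All.tabulate λ {y} y∈ → λ fx≡fy → All.lookup x∉ y∈ (inj (here refl) (there y∈) fx≡fy))
    ∷ map⁺-injectiveOn uniq (λ p q → inj (there p) (there q))

  injectiveOn⇒length≤ : ∀ {xs ys} → Unique xs → InjectiveOn xs → All (λ x → f x ∈ ys) xs →
                        length xs ≤ length ys
  injectiveOn⇒length≤ {xs} uniq inj into =
    subst (_≤ _) (length-map f xs) (unique⇒length≤ (map⁺-injectiveOn uniq inj) (All.map⁺ into))

module _ {a} {A : Set a} (_≟_ : DecidableEquality A) where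
  open DecMembership _≟_ using (_∈?_)

  injectiveOn-endo⇒onto : ∀ (f : A → A) {xs} → Unique xs → InjectiveOn f xs → All (λ x → f x ∈ xs) xs →
                           ∀ {y} → y ∈ xs → y ∈ map f xs
  injectiveOn-endo⇒onto f {xs} uniq inj into {y} y∈xs with y ∈? map f xs
  ... | yes y∈fxs = y∈fxs
  ... | no  y∉fxs = ⊥-elim (1+n≰n (subst (λ m → suc m ≤ length xs) (length-map f xs) too-long))
    where
    too-long : length (y ∷ map f xs) ≤ length xs
    too-long = unique⇒length≤ (All.¬Any⇒All¬ _ y∉fxs ∷ map⁺-injectiveOn f uniq inj)
                              (y∈xs ∷ All.map⁺ into)

module _ {a b c} {A : Set a} {B : Set b} {C : Set c} where

  length-cartesianProduct : ∀ (xs : List A) (ys : List B) →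
                            length (cartesianProduct xs ys) ≡ length xs * length ys
  length-cartesianProduct []       ys = refl
  length-cartesianProduct (x ∷ xs) ys = begin
    length (map (x ,_) ys ++ cartesianProduct xs ys)
      ≡⟨ length-++ (map (x ,_) ys) ⟩
    length (map (x ,_) ys) + length (cartesianProduct xs ys)
      ≡⟨ cong₂ _+_ (length-map (x ,_) ys) (length-cartesianProduct xs ys) ⟩
    length ys + length xs * length ys ∎
    where open ≡-Reasoning

  injectiveOn₂⇒length≤ : ∀ (f : A → B → C) {xs ys zs} → Unique xs → Unique ys →
    (∀ {x x′} y y′ → x ∈ xs → x′ ∈ xs → f x y ≡ f x′ y′ → x ≡ x′ × y ≡ y′) →
    (∀ {x} y → x ∈ xs → f x y ∈ zs) →
    length xs * length ys ≤ length zs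
  injectiveOn₂⇒length≤ f {xs} {ys} uniqx uniqy inj into =
    subst (_≤ _) (length-cartesianProduct xs ys)
      (injectiveOn⇒length≤ (uncurry f) (Unique.cartesianProduct⁺ uniqx uniqy) inj′
        (All.tabulate λ {(x , y)} p → into y (proj₁ (∈-cartesianProduct⁻ xs ys p))))
    where
    inj′ : InjectiveOn (uncurry f) (cartesianProduct xs ys)
    inj′ {x , y} {x′ , y′} p p′ e
      with refl , refl ← inj y y′ (proj₁ (∈-cartesianProduct⁻ xs ys p)) (proj₁ (∈-cartesianProduct⁻ xs ys p′)) e
      = refl

elements : ∀ {n} → Subset n → List (Fin n)
elements []          = []
elements (true ∷ p)  = zero ∷ map suc (elements p)
elements (false ∷ p) = map suc (elements p)

length-elements : ∀ {n} (p : Subset n) → length (elements p) ≡ ∣ p ∣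
length-elements []          = refl
length-elements (true ∷ p)  = cong suc (trans (length-map suc (elements p)) (length-elements p))
length-elements (false ∷ p) = trans (length-map suc (elements p)) (length-elements p)

∈-elements⁺ : ∀ {n} {x : Fin n} {p} → x ∈ₛ p → x ∈ elements p
∈-elements⁺ {p = true ∷ p}  here      = here refl
∈-elements⁺ {p = true ∷ p}  (there x∈) = there (∈-map⁺ suc (∈-elements⁺ x∈))
∈-elements⁺ {p = false ∷ p} (there x∈) = ∈-map⁺ suc (∈-elements⁺ x∈)

∈-elements⁻ : ∀ {n} {x : Fin n} p → x ∈ elements p → x ∈ₛ p
∈-elements⁻ (true ∷ p) (here refl) = here
∈-elements⁻ (true ∷ p) (there x∈) with ∈-map⁻ suc x∈
... | _ , y∈ , refl = there (∈-elements⁻ p y∈)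
∈-elements⁻ (false ∷ p) x∈ with ∈-map⁻ suc x∈
... | _ , y∈ , refl = there (∈-elements⁻ p y∈)

elements-unique : ∀ {n} (p : Subset n) → Unique (elements p)
elements-unique []          = []
elements-unique (true ∷ p)  =
  All.tabulate (λ x∈ → λ 0≡x → zero≢suc 0≡x x∈) ∷ Unique.map⁺ Fin.suc-injective (elements-unique p)
  where
  zero≢suc : ∀ {n} {x : Fin (suc n)} {xs} → zero ≡ x → ¬ (x ∈ map suc xs)
  zero≢suc refl z∈ with ∈-map⁻ suc z∈
  ... | _ , _ , ()
elements-unique (false ∷ p) = Unique.map⁺ Fin.suc-injective (elements-unique p)

unique⇒length≤n : ∀ {n} {xs : List (Fin n)} → Unique xs → length xs ≤ n
unique⇒length≤n {n} {xs} uniq =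
  subst (length xs ≤_) (length-tabulate id) (unique⇒length≤ uniq (All.universal ∈-allFin xs))

covers⇒n≤length : ∀ {n} {xs : List (Fin n)} → (∀ x → x ∈ xs) → n ≤ length xs
covers⇒n≤length {n} {xs} covers =
  subst (_≤ length xs) (length-tabulate id) (unique⇒length≤ (Unique.allFin⁺ n) (All.universal covers (allFin n)))

subsets : ∀ {n} → Subset n → List (Subset n)
subsets []          = [] ∷ []
subsets (true ∷ p)  = map (false ∷_) (subsets p) ++ map (true ∷_) (subsets p)
subsets (false ∷ p) = map (false ∷_) (subsets p)

length-subsets : ∀ {n} (p : Subset n) → length (subsets p) ≡ 2 ^ ∣ p ∣
length-subsets []          = refl
length-subsets (true ∷ p)  = begin
  length (map (false ∷_) (subsets p) ++ map (true ∷_) (subsets p))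
    ≡⟨ length-++ (map (false ∷_) (subsets p)) ⟩
  length (map (false ∷_) (subsets p)) + length (map (true ∷_) (subsets p))
    ≡⟨ cong₂ _+_ (length-map _ (subsets p)) (length-map _ (subsets p)) ⟩
  length (subsets p) + length (subsets p)
    ≡⟨ cong (λ m → m + m) (length-subsets p) ⟩
  2 ^ ∣ p ∣ + 2 ^ ∣ p ∣
    ≡⟨ cong (2 ^ ∣ p ∣ +_) (sym (+-identityʳ (2 ^ ∣ p ∣))) ⟩
  2 ^ suc ∣ p ∣ ∎
  where open ≡-Reasoning
length-subsets (false ∷ p) = trans (length-map _ (subsets p)) (length-subsets p)

∈-subsets : ∀ {n} {q p : Subset n} → q ⊆ p → q ∈ subsets p
∈-subsets {q = []}        {[]}        _   = here refl
∈-subsets {q = false ∷ q} {true ∷ p}  q⊆p = ∈-++⁺ˡ (∈-map⁺ (false ∷_) (∈-subsets (drop-∷-⊆ q⊆p)))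
∈-subsets {q = true ∷ q}  {true ∷ p}  q⊆p =
  ∈-++⁺ʳ (map (false ∷_) (subsets p)) (∈-map⁺ (true ∷_) (∈-subsets (drop-∷-⊆ q⊆p)))
∈-subsets {q = false ∷ q} {false ∷ p} q⊆p = ∈-map⁺ (false ∷_) (∈-subsets (drop-∷-⊆ q⊆p))
∈-subsets {q = true ∷ q}  {false ∷ p} q⊆p with q⊆p here
... | ()

subsets-unique : ∀ {n} (p : Subset n) → Unique (subsets p)
subsets-unique []          = [] ∷ []
subsets-unique (true ∷ p)  =
  Unique.++⁺ (Unique.map⁺ ∷-injectiveʳ (subsets-unique p)) (Unique.map⁺ ∷-injectiveʳ (subsets-unique p)) disjoint
  where
  disjoint : ∀ {q} → ¬ (q ∈ map (false ∷_) (subsets p) × q ∈ map (true ∷_) (subsets p))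
  disjoint (q∈₁ , q∈₂) with ∈-map⁻ (false ∷_) q∈₁ | ∈-map⁻ (true ∷_) q∈₂
  ... | _ , _ , refl | _ , _ , ()
subsets-unique (false ∷ p) = Unique.map⁺ ∷-injectiveʳ (subsets-unique p)

does-true⇒ : ∀ {p} {P : Set p} (P? : Dec P) → does P? ≡ true → P
does-true⇒ (yes p) _ = p

module _ {n : ℕ} where

  ≗-lookup⇒≡ : ∀ {a} {A : Set a} {xs ys : Vec A n} → (∀ i → lookup xs i ≡ lookup ys i) → xs ≡ ys
  ≗-lookup⇒≡ {xs = xs} {ys} eq = trans (sym (tabulate∘lookup xs)) (trans (tabulate-cong eq) (tabulate∘lookup ys))

  ∈-tabulate⁺ : ∀ {f : Fin n → Bool} {x} → f x ≡ true → x ∈ₛ tabulate f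
  ∈-tabulate⁺ {f} {x} fx = lookup⇒[]= x (tabulate f) (trans (lookup∘tabulate f x) fx)

  ∈-tabulate⁻ : ∀ {f : Fin n → Bool} {x} → x ∈ₛ tabulate f → f x ≡ true
  ∈-tabulate⁻ {f} {x} x∈ = trans (sym (lookup∘tabulate f x)) ([]=⇒lookup x∈)

  ∈-decided⁺ : ∀ {p} {P : Fin n → Set p} (P? : ∀ x → Dec (P x)) {x} → P x → x ∈ₛ tabulate (does ∘ P?)
  ∈-decided⁺ P? {x} px = ∈-tabulate⁺ (dec-true (P? x) px)

  ∈-decided⁻ : ∀ {p} {P : Fin n → Set p} (P? : ∀ x → Dec (P x)) {x} → x ∈ₛ tabulate (does ∘ P?) → P x
  ∈-decided⁻ P? {x} x∈ = does-true⇒ (P? x) (∈-tabulate⁻ {does ∘ P?} x∈)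

  lookup-∩ : ∀ (p q : Subset n) i → lookup (p ∩ q) i ≡ lookup p i ∧ lookup q i
  lookup-∩ p q i = lookup-zipWith _∧_ i p q

  ∩-cong-on : ∀ {p p′ : Subset n} q → (∀ i → i ∈ₛ q → lookup p i ≡ lookup p′ i) → p ∩ q ≡ p′ ∩ q
  ∩-cong-on {p} {p′} q eq = ≗-lookup⇒≡ λ i → begin
    lookup (p ∩ q) i          ≡⟨ lookup-∩ p q i ⟩
    lookup p i ∧ lookup q i   ≡⟨ cong-on (lookup q i) refl ⟩
    lookup p′ i ∧ lookup q i  ≡⟨ lookup-∩ p′ q i ⟨
    lookup (p′ ∩ q) i         ∎
    where
    open ≡-Reasoning
    cong-on : ∀ {i} b → lookup q i ≡ b → lookup p i ∧ b ≡ lookup p′ i ∧ b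
    cong-on {i} true  qi = cong (_∧ true) (eq i (lookup⇒[]= i q qi))
    cong-on {i} false _  = trans (∧-zeroʳ (lookup p i)) (sym (∧-zeroʳ (lookup p′ i)))

∩-⊂ : ∀ {n} {p q r : Subset n} {t} → p ⊆ q → t ∈ₛ q → t ∉ₛ p → t ∈ₛ r → p ∩ r ⊂ q ∩ r
∩-⊂ {p = p} {q} {r} p⊆q t∈q t∉p t∈r =
  (λ {x} x∈ → let x∈p , x∈r = Subset.x∈p∩q⁻ p r x∈ in Subset.x∈p∩q⁺ (p⊆q x∈p , x∈r)) ,
  _ , Subset.x∈p∩q⁺ (t∈q , t∈r) , t∉p ∘ proj₁ ∘ Subset.x∈p∩q⁻ p r

module GroupLemmas {n : ℕ} (G : FiniteGroup n) where
  open FiniteGroup G public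
  open IsGroup isGroup public using (assoc; identityˡ; identityʳ; inverseˡ; inverseʳ)

  group : Group _ _
  group = record { isGroup = isGroup }

  monoid : Monoid _ _
  monoid = Group.monoid group

  open GroupProperties group public using (⁻¹-involutive; ⁻¹-anti-homo-∙; ⁻¹-injective)

  x∙y∙y⁻¹≡x : ∀ x y → x ∙ y ∙ y ⁻¹ ≡ x
  x∙y∙y⁻¹≡x x y = trans (assoc x y (y ⁻¹)) (trans (cong (x ∙_) (inverseʳ y)) (identityʳ x))

  x∙y⁻¹∙y≡x : ∀ x y → x ∙ y ⁻¹ ∙ y ≡ x
  x∙y⁻¹∙y≡x x y = trans (assoc x (y ⁻¹) y) (trans (cong (x ∙_) (inverseˡ y)) (identityʳ x))

  x⁻¹∙[x∙y]≡y : ∀ x y → x ⁻¹ ∙ (x ∙ y) ≡ y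
  x⁻¹∙[x∙y]≡y x y = trans (sym (assoc (x ⁻¹) x y)) (trans (cong (_∙ y) (inverseˡ x)) (identityˡ y))

  x∙[x⁻¹∙y]≡y : ∀ x y → x ∙ (x ⁻¹ ∙ y) ≡ y
  x∙[x⁻¹∙y]≡y x y = trans (sym (assoc x (x ⁻¹) y)) (trans (cong (_∙ y) (inverseʳ x)) (identityˡ y))

  ∙-cancelˡ : ∀ g {x y} → g ∙ x ≡ g ∙ y → x ≡ y
  ∙-cancelˡ g {x} {y} eq = trans (sym (x⁻¹∙[x∙y]≡y g x)) (trans (cong (g ⁻¹ ∙_) eq) (x⁻¹∙[x∙y]≡y g y))

  conj : Fin n → Fin n → Fin n
  conj g x = g ∙ x ∙ g ⁻¹

  conj-∙ : ∀ g h x → conj (g ∙ h) x ≡ conj g (conj h x)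
  conj-∙ g h x = trans (cong (g ∙ h ∙ x ∙_) (⁻¹-anti-homo-∙ g h)) (solve monoid)

  conj⁻¹-conj : ∀ g x → conj (g ⁻¹) (conj g x) ≡ x
  conj⁻¹-conj g x = begin
    g ⁻¹ ∙ (g ∙ x ∙ g ⁻¹) ∙ g ⁻¹ ⁻¹ ≡⟨ cong (g ⁻¹ ∙ (g ∙ x ∙ g ⁻¹) ∙_) (⁻¹-involutive g) ⟩
    g ⁻¹ ∙ (g ∙ x ∙ g ⁻¹) ∙ g       ≡⟨ solve monoid ⟩
    (g ⁻¹ ∙ g) ∙ x ∙ (g ⁻¹ ∙ g)     ≡⟨ cong₂ (λ u v → u ∙ x ∙ v) (inverseˡ g) (inverseˡ g) ⟩
    ε ∙ x ∙ ε                       ≡⟨ trans (identityʳ _) (identityˡ x) ⟩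
    x                               ∎
    where open ≡-Reasoning

  conj-⁻¹ : ∀ g h → conj g (h ⁻¹) ≡ conj g h ⁻¹
  conj-⁻¹ g h = sym (begin
    (g ∙ h ∙ g ⁻¹) ⁻¹        ≡⟨ ⁻¹-anti-homo-∙ (g ∙ h) (g ⁻¹) ⟩
    g ⁻¹ ⁻¹ ∙ (g ∙ h) ⁻¹     ≡⟨ cong₂ _∙_ (⁻¹-involutive g) (⁻¹-anti-homo-∙ g h) ⟩
    g ∙ (h ⁻¹ ∙ g ⁻¹)        ≡⟨ assoc g (h ⁻¹) (g ⁻¹) ⟨
    g ∙ h ⁻¹ ∙ g ⁻¹          ∎)
    where open ≡-Reasoning

  conj-injective : ∀ g {x y} → conj g x ≡ conj g y → x ≡ y
  conj-injective g {x} {y} eq = trans (sym (conj⁻¹-conj g x)) (trans (cong (conj (g ⁻¹)) eq) (conj⁻¹-conj g y))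

  [h⁻¹∙x]⁻¹∙[x∙h]⁻¹≡x⁻¹∙x⁻¹ : ∀ x h → (h ⁻¹ ∙ x) ⁻¹ ∙ (x ∙ h) ⁻¹ ≡ x ⁻¹ ∙ x ⁻¹
  [h⁻¹∙x]⁻¹∙[x∙h]⁻¹≡x⁻¹∙x⁻¹ x h = begin
    (h ⁻¹ ∙ x) ⁻¹ ∙ (x ∙ h) ⁻¹        ≡⟨ cong₂ _∙_ (⁻¹-anti-homo-∙ (h ⁻¹) x) (⁻¹-anti-homo-∙ x h) ⟩
    x ⁻¹ ∙ h ⁻¹ ⁻¹ ∙ (h ⁻¹ ∙ x ⁻¹)    ≡⟨ solve monoid ⟩
    x ⁻¹ ∙ (h ⁻¹ ⁻¹ ∙ (h ⁻¹ ∙ x ⁻¹))  ≡⟨ cong (x ⁻¹ ∙_) (x⁻¹∙[x∙y]≡y (h ⁻¹) (x ⁻¹)) ⟩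
    x ⁻¹ ∙ x ⁻¹                       ∎
    where open ≡-Reasoning

  [x⁻¹∙x⁻¹]⁻¹∙[x⁻¹∙[x∙h]⁻¹]≡conj[x,h⁻¹] : ∀ x h → (x ⁻¹ ∙ x ⁻¹) ⁻¹ ∙ (x ⁻¹ ∙ (x ∙ h) ⁻¹) ≡ conj x (h ⁻¹)
  [x⁻¹∙x⁻¹]⁻¹∙[x⁻¹∙[x∙h]⁻¹]≡conj[x,h⁻¹] x h = begin
    (x ⁻¹ ∙ x ⁻¹) ⁻¹ ∙ (x ⁻¹ ∙ (x ∙ h) ⁻¹)
      ≡⟨ cong₂ (λ u v → u ∙ (x ⁻¹ ∙ v)) (⁻¹-anti-homo-∙ (x ⁻¹) (x ⁻¹)) (⁻¹-anti-homo-∙ x h) ⟩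
    x ⁻¹ ⁻¹ ∙ x ⁻¹ ⁻¹ ∙ (x ⁻¹ ∙ (h ⁻¹ ∙ x ⁻¹))
      ≡⟨ cong (λ u → u ∙ u ∙ (x ⁻¹ ∙ (h ⁻¹ ∙ x ⁻¹))) (⁻¹-involutive x) ⟩
    x ∙ x ∙ (x ⁻¹ ∙ (h ⁻¹ ∙ x ⁻¹))
      ≡⟨ assoc x x _ ⟩
    x ∙ (x ∙ (x ⁻¹ ∙ (h ⁻¹ ∙ x ⁻¹)))
      ≡⟨ cong (x ∙_) (x∙[x⁻¹∙y]≡y x (h ⁻¹ ∙ x ⁻¹)) ⟩
    x ∙ (h ⁻¹ ∙ x ⁻¹)
      ≡⟨ assoc x (h ⁻¹) (x ⁻¹) ⟨
    conj x (h ⁻¹)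
      ∎
    where open ≡-Reasoning

  [h⁻¹∙x]⁻¹≡x⁻¹∙[x∙h]⁻¹∙x∙[h∙h] : ∀ x h → (h ⁻¹ ∙ x) ⁻¹ ≡ x ⁻¹ ∙ (x ∙ h) ⁻¹ ∙ x ∙ (h ∙ h)
  [h⁻¹∙x]⁻¹≡x⁻¹∙[x∙h]⁻¹∙x∙[h∙h] x h = begin
    (h ⁻¹ ∙ x) ⁻¹                           ≡⟨ ⁻¹-anti-homo-∙ (h ⁻¹) x ⟩
    x ⁻¹ ∙ h ⁻¹ ⁻¹                          ≡⟨ cong (x ⁻¹ ∙_) (⁻¹-involutive h) ⟩
    x ⁻¹ ∙ h                                ≡⟨ cong (_∙ h) (x∙y⁻¹∙y≡x (x ⁻¹) (x ∙ h)) ⟨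
    x ⁻¹ ∙ (x ∙ h) ⁻¹ ∙ (x ∙ h) ∙ h         ≡⟨ solve monoid ⟩
    x ⁻¹ ∙ (x ∙ h) ⁻¹ ∙ x ∙ (h ∙ h)         ∎
    where open ≡-Reasoning

module Normaliser {n : ℕ} (R : FiniteGroup n) (Q : Subset n) (sg : IsSubgroup R Q) where
  open GroupLemmas R
  open IsSubgroup sg

  Normalises : Fin n → Set
  Normalises g = ∀ h → h ∈ₛ Q → conj g h ∈ₛ Q

  normalises? : ∀ g → Dec (Normalises g)
  normalises? g = Fin.all? λ h → (h Subset.∈? Q) →-dec (conj g h Subset.∈? Q)

  ∙-normalises : ∀ {g h} → Normalises g → Normalises h → Normalises (g ∙ h)
  ∙-normalises {g} {h} ng nh x x∈Q = subst (_∈ₛ Q) (sym (conj-∙ g h x)) (ng _ (nh x x∈Q))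

  -- conjugation by g is an injective self-map of the finite set Q, hence onto Q
  ⁻¹-normalises : ∀ {g} → Normalises g → Normalises (g ⁻¹)
  ⁻¹-normalises {g} ng h h∈Q with ∈-map⁻ (conj g) (injectiveOn-endo⇒onto Fin._≟_ (conj g) (elements-unique Q)
      (λ _ _ → conj-injective g) (All.tabulate (∈-elements⁺ ∘ ng _ ∘ ∈-elements⁻ Q)) (∈-elements⁺ h∈Q))
  ... | h′ , h′∈ , refl = subst (_∈ₛ Q) (sym (conj⁻¹-conj g h′)) (∈-elements⁻ Q h′∈)

  ¬normalises⇒witness : ∀ {g} → ¬ Normalises g → Σ (Fin n) λ h → h ∈ₛ Q × conj g h ∉ₛ Q
  ¬normalises⇒witness {g} ¬ng
    with h , ¬[h∈Q→gh∈Q] ← Fin.¬∀⟶∃¬ n _ (λ h → (h Subset.∈? Q) →-dec (conj g h Subset.∈? Q)) ¬ng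
    with h Subset.∈? Q
  ... | yes h∈Q = h , h∈Q , λ gh∈Q → ¬[h∈Q→gh∈Q] (λ _ → gh∈Q)
  ... | no  h∉Q = ⊥-elim (¬[h∈Q→gh∈Q] (⊥-elim ∘ h∉Q))

  ¬normal⇒¬normalises : ¬ IsNormal R Q → Σ (Fin n) λ g → ¬ Normalises g
  ¬normal⇒¬normalises = Fin.¬∀⟶∃¬ n Normalises normalises?

  normaliser : Subset n
  normaliser = tabulate (does ∘ normalises?)

  normaliser-list : List (Fin n)
  normaliser-list = elements normaliser

  ∈-normaliser-list⁻ : ∀ {g} → g ∈ normaliser-list → Normalises g
  ∈-normaliser-list⁻ = ∈-decided⁻ normalises? ∘ ∈-elements⁻ normaliser

  ∈-normaliser-list⁺ : ∀ {g} → Normalises g → g ∈ normaliser-list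
  ∈-normaliser-list⁺ = ∈-elements⁺ ∘ ∈-decided⁺ normalises?

  ¬normalises⇒normaliser-half : ∀ {g} → ¬ Normalises g → length normaliser-list + length normaliser-list ≤ n
  ¬normalises⇒normaliser-half {g} ¬ng =
    subst (_≤ n) (trans (length-++ N) (cong (length N +_) (length-map (g ∙_) N)))
      (unique⇒length≤n (Unique.++⁺ (elements-unique normaliser)
                                   (Unique.map⁺ (∙-cancelˡ g) (elements-unique normaliser)) disjoint))
    where
    N = normaliser-list
    disjoint : ∀ {x} → ¬ (x ∈ N × x ∈ map (g ∙_) N)
    disjoint (x∈N , x∈gN) with ∈-map⁻ (g ∙_) x∈gN
    ... | y , y∈N , refl = ¬ng (subst Normalises (x∙y∙y⁻¹≡x g y)
                                 (∙-normalises (∈-normaliser-list⁻ x∈N) (⁻¹-normalises (∈-normaliser-list⁻ y∈N))))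

module InversionRepresentatives {n : ℕ} (G : FiniteGroup n) where
  open GroupLemmas G

  record InverseClosedᵇ (S : Subset n) : Set where
    field lookup-⁻¹ : ∀ g → lookup S (g ⁻¹) ≡ lookup S g
  open InverseClosedᵇ public

  inverseClosed⇒ᵇ : ∀ {S} → InverseClosed G S → InverseClosedᵇ S
  inverseClosed⇒ᵇ {S} closed .lookup-⁻¹ g = ⇔→≡ (mk⇔ (λ e → []=⇒lookup (proj₂ (closed g) (lookup⇒[]= _ S e)))
                                                      (λ e → []=⇒lookup (proj₁ (closed g) (lookup⇒[]= _ S e))))

  representatives : Subset n
  representatives = tabulate (λ g → does (g Fin.≤? g ⁻¹))

  ascending : Subset n
  ascending = tabulate (λ g → does (g Fin.<? g ⁻¹))

  representative-or-inverse : ∀ g → g ∈ₛ representatives ⊎ g ⁻¹ ∈ₛ representatives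
  representative-or-inverse g with Fin.≤-total g (g ⁻¹)
  ... | inj₁ g≤g⁻¹ = inj₁ (∈-decided⁺ (λ x → x Fin.≤? x ⁻¹) g≤g⁻¹)
  ... | inj₂ g⁻¹≤g = inj₂ (∈-decided⁺ (λ x → x Fin.≤? x ⁻¹) (subst (g ⁻¹ ≤ᶠ_) (sym (⁻¹-involutive g)) g⁻¹≤g))

  self-inverse⇒involutionOrId : ∀ {g} → g ≡ g ⁻¹ → g ∈ₛ involutionsAndId G
  self-inverse⇒involutionOrId {g} g≡g⁻¹ =
    ∈-decided⁺ (λ x → x ∙ x Fin.≟ ε) (trans (cong (g ∙_) g≡g⁻¹) (inverseʳ g))

  ∣representatives∣≤∣involutionsAndId∣+∣ascending∣ :
    ∣ representatives ∣ ≤ ∣ involutionsAndId G ∣ + ∣ ascending ∣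
  ∣representatives∣≤∣involutionsAndId∣+∣ascending∣ =
    subst₂ _≤_ (length-elements representatives)
               (trans (length-++ (elements I)) (cong₂ _+_ (length-elements I) (length-elements ascending)))
      (unique⇒length≤ (elements-unique representatives)
                      (All.tabulate (involution-or-ascending ∘ ∈-elements⁻ representatives)))
    where
    I = involutionsAndId G
    involution-or-ascending : ∀ {g} → g ∈ₛ representatives → g ∈ elements I ++ elements ascending
    involution-or-ascending {g} g∈ with g Fin.≟ g ⁻¹
    ... | yes g≡g⁻¹ = ∈-++⁺ˡ (∈-elements⁺ (self-inverse⇒involutionOrId g≡g⁻¹))
    ... | no  g≢g⁻¹ = ∈-++⁺ʳ (elements I) (∈-elements⁺ (∈-decided⁺ (λ x → x Fin.<? x ⁻¹)
                        (Fin.≤∧≢⇒< (∈-decided⁻ (λ x → x Fin.≤? x ⁻¹) g∈) g≢g⁻¹)))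

  inverseClosed-∩representatives-injective : ∀ {S S′} → InverseClosedᵇ S → InverseClosedᵇ S′ →
    S ∩ representatives ≡ S′ ∩ representatives → S ≡ S′
  inverseClosed-∩representatives-injective {S} {S′} closed closed′ eq =
    ≗-lookup⇒≡ λ g → [ on-representatives , via-inverse ]′ (representative-or-inverse g)
    where
    on-representatives : ∀ {g} → g ∈ₛ representatives → lookup S g ≡ lookup S′ g
    on-representatives {g} g∈ = begin
      lookup S g                              ≡⟨ ∧-identityʳ (lookup S g) ⟨
      lookup S g ∧ true                       ≡⟨ cong (lookup S g ∧_) ([]=⇒lookup g∈) ⟨
      lookup S g ∧ lookup representatives g   ≡⟨ lookup-∩ S representatives g ⟨
      lookup (S ∩ representatives) g          ≡⟨ cong (λ X → lookup X g) eq ⟩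
      lookup (S′ ∩ representatives) g         ≡⟨ lookup-∩ S′ representatives g ⟩
      lookup S′ g ∧ lookup representatives g  ≡⟨ cong (lookup S′ g ∧_) ([]=⇒lookup g∈) ⟩
      lookup S′ g ∧ true                      ≡⟨ ∧-identityʳ (lookup S′ g) ⟩
      lookup S′ g                             ∎
      where open ≡-Reasoning
    via-inverse : ∀ {g} → g ⁻¹ ∈ₛ representatives → lookup S g ≡ lookup S′ g
    via-inverse {g} g⁻¹∈ = trans (sym (lookup-⁻¹ closed g)) (trans (on-representatives g⁻¹∈) (lookup-⁻¹ closed′ g))

  -- the inverse of an ascending element is never a representative
  ∣representatives∣+∣ascending∣≤n : ∣ representatives ∣ + ∣ ascending ∣ ≤ n
  ∣representatives∣+∣ascending∣≤n =
    subst (_≤ n) (trans (length-++ (elements representatives))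
                        (cong₂ _+_ (length-elements representatives)
                                   (trans (length-map _⁻¹ (elements ascending)) (length-elements ascending))))
      (unique⇒length≤n (Unique.++⁺ (elements-unique representatives)
                                   (Unique.map⁺ ⁻¹-injective (elements-unique ascending)) disjoint))
    where
    disjoint : ∀ {x} → ¬ (x ∈ elements representatives × x ∈ map _⁻¹ (elements ascending))
    disjoint (x∈reps , x∈asc⁻¹) with ∈-map⁻ _⁻¹ x∈asc⁻¹
    ... | y , y∈asc , refl =
      ℕ.<⇒≱ (∈-decided⁻ (λ x → x Fin.<? x ⁻¹) (∈-elements⁻ ascending y∈asc))
            (subst (y ⁻¹ ≤ᶠ_) (⁻¹-involutive y) (∈-decided⁻ (λ x → x Fin.≤? x ⁻¹) (∈-elements⁻ representatives x∈reps)))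

  ∣representatives∣+∣representatives∣≤n+∣involutionsAndId∣ :
    ∣ representatives ∣ + ∣ representatives ∣ ≤ n + ∣ involutionsAndId G ∣
  ∣representatives∣+∣representatives∣≤n+∣involutionsAndId∣ = begin
    ∣ P ∣ + ∣ P ∣       ≤⟨ ℕ.+-monoʳ-≤ ∣ P ∣ ∣representatives∣≤∣involutionsAndId∣+∣ascending∣ ⟩
    ∣ P ∣ + (i + a)     ≡⟨ ℕ.+-assoc ∣ P ∣ i a ⟨
    (∣ P ∣ + i) + a     ≡⟨ cong (_+ a) (ℕ.+-comm ∣ P ∣ i) ⟩
    (i + ∣ P ∣) + a     ≡⟨ ℕ.+-assoc i ∣ P ∣ a ⟩
    i + (∣ P ∣ + a)     ≤⟨ ℕ.+-monoʳ-≤ i ∣representatives∣+∣ascending∣≤n ⟩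
    i + n               ≡⟨ ℕ.+-comm i n ⟩
    n + i               ∎
    where
    open ℕ.≤-Reasoning
    P = representatives
    i = ∣ involutionsAndId G ∣
    a = ∣ ascending ∣

module Toggling {n : ℕ} (G : FiniteGroup n) where
  open GroupLemmas G
  open InversionRepresentatives G using (InverseClosedᵇ; lookup-⁻¹)

  InOrbit : Fin n → Fin n → Set
  InOrbit t x = x ≡ t ⊎ x ≡ t ⁻¹

  inOrbit? : ∀ t x → Dec (InOrbit t x)
  inOrbit? t x = (x Fin.≟ t) ⊎-dec (x Fin.≟ t ⁻¹)

  orbit : Fin n → Fin n → Bool
  orbit t x = does (inOrbit? t x)

  orbit-self : ∀ t → orbit t t ≡ true
  orbit-self t = dec-true (inOrbit? t t) (inj₁ refl)

  orbit-⁻¹ : ∀ t x → orbit t (x ⁻¹) ≡ orbit t x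
  orbit-⁻¹ t x = does-⇔ (mk⇔ from-⁻¹ to-⁻¹) (inOrbit? t (x ⁻¹)) (inOrbit? t x)
    where
    from-⁻¹ : InOrbit t (x ⁻¹) → InOrbit t x
    from-⁻¹ (inj₁ refl) = inj₂ (sym (⁻¹-involutive x))
    from-⁻¹ (inj₂ eq)   = inj₁ (⁻¹-injective eq)
    to-⁻¹ : InOrbit t x → InOrbit t (x ⁻¹)
    to-⁻¹ (inj₁ refl) = inj₂ refl
    to-⁻¹ (inj₂ refl) = inj₁ (⁻¹-involutive t)

  lookup-orbit : ∀ {S} → InverseClosedᵇ S → ∀ {t x} → orbit t x ≡ true → lookup S x ≡ lookup S t
  lookup-orbit closed {t} {x} on with does-true⇒ (inOrbit? t x) on
  ... | inj₁ refl = refl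
  ... | inj₂ refl = lookup-⁻¹ closed t

  toggle : Bool → Fin n → Subset n → Subset n
  toggle c t S = tabulate (λ x → lookup S x xor (c ∧ orbit t x))

  lookup-toggle : ∀ c t S x → lookup (toggle c t S) x ≡ lookup S x xor (c ∧ orbit t x)
  lookup-toggle c t S x = lookup∘tabulate (λ x → lookup S x xor (c ∧ orbit t x)) x

  toggle-involutive : ∀ c t S → toggle c t (toggle c t S) ≡ S
  toggle-involutive c t S = ≗-lookup⇒≡ λ x → let o = c ∧ orbit t x in begin
    lookup (toggle c t (toggle c t S)) x ≡⟨ lookup-toggle c t (toggle c t S) x ⟩
    lookup (toggle c t S) x xor o        ≡⟨ cong (_xor o) (lookup-toggle c t S x) ⟩
    (lookup S x xor o) xor o             ≡⟨ xor-assoc (lookup S x) o o ⟩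
    lookup S x xor (o xor o)             ≡⟨ cong (lookup S x xor_) (xor-same o) ⟩
    lookup S x xor false                 ≡⟨ xor-identityʳ (lookup S x) ⟩
    lookup S x                           ∎
    where open ≡-Reasoning

  toggle-injective : ∀ c t {S S′} → toggle c t S ≡ toggle c t S′ → S ≡ S′
  toggle-injective c t {S} {S′} eq =
    trans (sym (toggle-involutive c t S)) (trans (cong (toggle c t) eq) (toggle-involutive c t S′))

  toggle-false : ∀ t S → toggle false t S ≡ S
  toggle-false t S = ≗-lookup⇒≡ λ x → trans (lookup-toggle false t S x) (xor-identityʳ (lookup S x))

  toggle-inverseClosed : ∀ c t {S} → InverseClosedᵇ S → InverseClosedᵇ (toggle c t S)
  toggle-inverseClosed c t {S} closed .lookup-⁻¹ g = begin
    lookup (toggle c t S) (g ⁻¹)                ≡⟨ lookup-toggle c t S (g ⁻¹) ⟩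
    lookup S (g ⁻¹) xor (c ∧ orbit t (g ⁻¹))    ≡⟨ cong₂ (λ u v → u xor (c ∧ v)) (lookup-⁻¹ closed g) (orbit-⁻¹ t g) ⟩
    lookup S g xor (c ∧ orbit t g)              ≡⟨ lookup-toggle c t S g ⟨
    lookup (toggle c t S) g                     ∎
    where open ≡-Reasoning

  orbit-false : ∀ {t x} → ¬ InOrbit t x → orbit t x ≡ false
  orbit-false {t} {x} = dec-false (inOrbit? t x)

  lookup-toggle-off : ∀ c t S {x} → orbit t x ≡ false → lookup (toggle c t S) x ≡ lookup S x
  lookup-toggle-off c t S {x} off = begin
    lookup (toggle c t S) x          ≡⟨ lookup-toggle c t S x ⟩
    lookup S x xor (c ∧ orbit t x)   ≡⟨ cong (λ o → lookup S x xor (c ∧ o)) off ⟩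
    lookup S x xor (c ∧ false)       ≡⟨ cong (lookup S x xor_) (∧-zeroʳ c) ⟩
    lookup S x xor false             ≡⟨ xor-identityʳ (lookup S x) ⟩
    lookup S x                       ∎
    where open ≡-Reasoning

  lookup-toggle-on : ∀ t {S} → InverseClosedᵇ S → ∀ {x} → orbit t x ≡ true →
                     lookup (toggle true t S) x ≡ not (lookup S t)
  lookup-toggle-on t {S} closed {x} on = begin
    lookup (toggle true t S) x        ≡⟨ lookup-toggle true t S x ⟩
    lookup S x xor orbit t x          ≡⟨ cong₂ _xor_ (lookup-orbit closed on) on ⟩
    lookup S t xor true               ≡⟨ xor-comm (lookup S t) true ⟩
    not (lookup S t)                  ∎
    where open ≡-Reasoning

  toggle⊆ : ∀ t {S} → InverseClosedᵇ S → lookup S t ≡ true → toggle true t S ⊆ S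
  toggle⊆ t {S} closed St {x} x∈ with orbit t x in on
  ... | true with () ← trans (cong not (sym St)) (trans (sym (lookup-toggle-on t closed on)) ([]=⇒lookup x∈))
  ... | false = lookup⇒[]= x S (trans (sym (lookup-toggle-off true t S on)) ([]=⇒lookup x∈))

  ⊆toggle : ∀ t {S} → InverseClosedᵇ S → lookup S t ≡ false → S ⊆ toggle true t S
  ⊆toggle t {S} closed St {x} x∈ with orbit t x in on
  ... | true with () ← trans (sym St) (trans (sym (lookup-orbit closed on)) ([]=⇒lookup x∈))
  ... | false = lookup⇒[]= x _ (trans (lookup-toggle-off true t S on) ([]=⇒lookup x∈))

  ∣toggle∩∣≢∣∩∣ : ∀ t {S A} → InverseClosedᵇ S → t ∈ₛ A → ∣ toggle true t S ∩ A ∣ ≢ ∣ S ∩ A ∣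
  ∣toggle∩∣≢∣∩∣ t {S} closed t∈A with lookup S t in St
  ... | true  = ℕ.<⇒≢ (Subset.p⊂q⇒∣p∣<∣q∣ (∩-⊂ (toggle⊆ t closed St) (lookup⇒[]= t S St) t∉toggle t∈A))
    where
    t∉toggle : t ∉ₛ toggle true t S
    t∉toggle t∈ with () ← trans (cong not (sym St)) (trans (sym (lookup-toggle-on t closed (orbit-self t))) ([]=⇒lookup t∈))
  ... | false = ℕ.<⇒≢ (Subset.p⊂q⇒∣p∣<∣q∣ (∩-⊂ (⊆toggle t closed St) t∈toggle t∉S t∈A)) ∘ sym
    where
    t∈toggle : t ∈ₛ toggle true t S
    t∈toggle = lookup⇒[]= t _ (trans (lookup-toggle-on t closed (orbit-self t)) (cong not St))
    t∉S : t ∉ₛ S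
    t∉S t∈ with () ← trans (sym St) ([]=⇒lookup t∈)

module Cosets {n : ℕ} (R : FiniteGroup n) (Q : Subset n) (sg : IsSubgroup R Q) where
  open GroupLemmas R
  open IsSubgroup sg

  InCoset : Fin n → Fin n → Set
  InCoset y x = x ∙ y ⁻¹ ∈ₛ Q

  inCoset? : ∀ y x → Dec (InCoset y x)
  inCoset? y x = (x ∙ y ⁻¹) Subset.∈? Q

  ∈-rightCoset⁻ : ∀ {y x} → x ∈ₛ rightCoset R Q y → InCoset y x
  ∈-rightCoset⁻ {y} {x} x∈ = lookup⇒[]= (x ∙ y ⁻¹) Q (∈-tabulate⁻ x∈)

  ∈-rightCoset⁺ : ∀ {y x} → InCoset y x → x ∈ₛ rightCoset R Q y
  ∈-rightCoset⁺ x∈Qy = ∈-tabulate⁺ ([]=⇒lookup x∈Qy)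

  ∈Q-cancelˡ : ∀ {x y} → x ∈ₛ Q → x ∙ y ∈ₛ Q → y ∈ₛ Q
  ∈Q-cancelˡ {x} {y} x∈Q xy∈Q = subst (_∈ₛ Q) (x⁻¹∙[x∙y]≡y x y) (∙-closed (⁻¹-closed x∈Q) xy∈Q)

  ∈Q-⁻¹⁻ : ∀ {x} → x ⁻¹ ∈ₛ Q → x ∈ₛ Q
  ∈Q-⁻¹⁻ {x} x⁻¹∈Q = subst (_∈ₛ Q) (⁻¹-involutive x) (⁻¹-closed x⁻¹∈Q)

  x∈Qx : ∀ x → InCoset x x
  x∈Qx x = subst (_∈ₛ Q) (sym (inverseʳ x)) ε∈

  InDoubleCoset? : ∀ x y → Dec (InDoubleCoset R Q x y)
  InDoubleCoset? x y = Fin.any? λ q → Fin.any? λ q′ →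
    (q Subset.∈? Q) ×-dec (q′ Subset.∈? Q) ×-dec (y Fin.≟ q ∙ x ∙ q′)

  InDoubleCoset-coset : ∀ {x u c} → InDoubleCoset R Q x u → InCoset c u → InDoubleCoset R Q x c
  InDoubleCoset-coset {x} {c = c} (q , q′ , q∈Q , q′∈Q , refl) u∈Qc =
    (u ∙ c ⁻¹) ⁻¹ ∙ q , q′ , ∙-closed (⁻¹-closed u∈Qc) q∈Q , q′∈Q , (begin
      c                               ≡⟨ x∙y⁻¹∙y≡x c u ⟨
      c ∙ u ⁻¹ ∙ u                    ≡⟨ cong (λ z → z ∙ u ⁻¹ ∙ u) (⁻¹-involutive c) ⟨
      c ⁻¹ ⁻¹ ∙ u ⁻¹ ∙ u              ≡⟨ cong (_∙ u) (⁻¹-anti-homo-∙ u (c ⁻¹)) ⟨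
      (u ∙ c ⁻¹) ⁻¹ ∙ u               ≡⟨ solve monoid ⟩
      (u ∙ c ⁻¹) ⁻¹ ∙ q ∙ x ∙ q′      ∎)
    where
    open ≡-Reasoning
    u = q ∙ x ∙ q′

  InDoubleCoset-refl : ∀ x → InDoubleCoset R Q x x
  InDoubleCoset-refl x = ε , ε , ε∈ , ε∈ , sym (trans (identityʳ _) (identityˡ x))

  conj⁻¹∉Q : ∀ {x h} → conj x h ∉ₛ Q → conj x (h ⁻¹) ∉ₛ Q
  conj⁻¹∉Q {x} {h} xhx⁻¹∉Q xh⁻¹x⁻¹∈Q = xhx⁻¹∉Q (∈Q-⁻¹⁻ (subst (_∈ₛ Q) (conj-⁻¹ x h) xh⁻¹x⁻¹∈Q))

  x∉Qxh : ∀ {x h} → conj x h ∉ₛ Q → ¬ InCoset (x ∙ h) x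
  x∉Qxh {x} {h} xhx⁻¹∉Q x∈Qxh = conj⁻¹∉Q xhx⁻¹∉Q (subst (_∈ₛ Q) (begin
    x ∙ (x ∙ h) ⁻¹         ≡⟨ cong (x ∙_) (⁻¹-anti-homo-∙ x h) ⟩
    x ∙ (h ⁻¹ ∙ x ⁻¹)      ≡⟨ assoc x (h ⁻¹) (x ⁻¹) ⟨
    conj x (h ⁻¹)          ∎) x∈Qxh)
    where open ≡-Reasoning

  xh∈QxQ : ∀ {x h} → h ∈ₛ Q → InDoubleCoset R Q x (x ∙ h)
  xh∈QxQ {x} h∈Q = ε , _ , ε∈ , h∈Q , cong (_∙ _) (sym (identityˡ x))

module Gadgets {n : ℕ} (R : FiniteGroup n) (Q : Subset n) (sg : IsSubgroup R Q) where
  open GroupLemmas R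
  open InversionRepresentatives R
  open Toggling R
  open Cosets R Q sg

  MissesCoset : Fin n → Fin n → Set
  MissesCoset t y = ¬ InCoset y t × ¬ InCoset y (t ⁻¹)

  record Gadget : Set where
    field
      a b t  : Fin n
      t∈Qa   : InCoset a t
      avoids : MissesCoset t b
      b∈QaQ  : InDoubleCoset R Q a b
  open Gadget public

  MissesCosets : Fin n → Gadget → Set
  MissesCosets t g = MissesCoset t (a g) × MissesCoset t (b g)

  -- each gadget's cosets are untouched by the toggles of the gadgets after it
  Independent : List Gadget → Set
  Independent = AllPairs (λ g g′ → MissesCosets (t g′) g)

  Balanced : Subset n → Gadget → Set
  Balanced S g = ∣ S ∩ rightCoset R Q (a g) ∣ ≡ ∣ S ∩ rightCoset R Q (b g) ∣

  toggle-∩-off : ∀ c t S {y} → MissesCoset t y → toggle c t S ∩ rightCoset R Q y ≡ S ∩ rightCoset R Q y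
  toggle-∩-off c t S (t∉Qy , t⁻¹∉Qy) = ∩-cong-on _ λ x x∈Qy →
    lookup-toggle-off c t S (orbit-false {t} {x} λ { (inj₁ refl) → t∉Qy (∈-rightCoset⁻ x∈Qy)
                                           ; (inj₂ refl) → t⁻¹∉Qy (∈-rightCoset⁻ x∈Qy) })

  toggle-bit-determined : ∀ g {Y Y′} c c′ → InverseClosedᵇ Y → InverseClosedᵇ Y′ →
    Balanced Y g → Balanced Y′ g → toggle c (t g) Y ≡ toggle c′ (t g) Y′ → c ≡ c′
  toggle-bit-determined g true  true  _ _ _ _ _ = refl
  toggle-bit-determined g false false _ _ _ _ _ = refl
  toggle-bit-determined g {Y} {Y′} true false closed _ bal bal′ eq =
    ⊥-elim (∣toggle∩∣≢∣∩∣ (t g) closed (∈-rightCoset⁺ (t∈Qa g)) (begin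
      ∣ toggle true (t g) Y ∩ A ∣   ≡⟨ cong (λ X → ∣ X ∩ A ∣) (trans eq (toggle-false (t g) Y′)) ⟩
      ∣ Y′ ∩ A ∣                    ≡⟨ bal′ ⟩
      ∣ Y′ ∩ B ∣                    ≡⟨ cong (λ X → ∣ X ∩ B ∣) (trans (sym (toggle-false (t g) Y′)) (sym eq)) ⟩
      ∣ toggle true (t g) Y ∩ B ∣   ≡⟨ cong ∣_∣ (toggle-∩-off true (t g) Y (avoids g)) ⟩
      ∣ Y ∩ B ∣                     ≡⟨ bal ⟨
      ∣ Y ∩ A ∣                     ∎))
    where
    open ≡-Reasoning
    A = rightCoset R Q (a g)
    B = rightCoset R Q (b g)
  toggle-bit-determined g {Y} {Y′} false true closed closed′ bal bal′ eq =
    sym (toggle-bit-determined g {Y′} {Y} true false closed′ closed bal′ bal (sym eq))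

  toggles : (gs : List Gadget) → Vec Bool (length gs) → Subset n → Subset n
  toggles []       []       S = S
  toggles (g ∷ gs) (c ∷ cs) S = toggle c (t g) (toggles gs cs S)

  toggles-inverseClosed : ∀ gs cs {S} → InverseClosedᵇ S → InverseClosedᵇ (toggles gs cs S)
  toggles-inverseClosed []       []       closed = closed
  toggles-inverseClosed (g ∷ gs) (c ∷ cs) closed = toggle-inverseClosed c (t g) (toggles-inverseClosed gs cs closed)

  toggles-injective : ∀ gs cs {S S′} → toggles gs cs S ≡ toggles gs cs S′ → S ≡ S′
  toggles-injective []       []       eq = eq
  toggles-injective (g ∷ gs) (c ∷ cs) eq = toggles-injective gs cs (toggle-injective c (t g) eq)

  toggles-∩-off : ∀ gs cs S {y} → All (λ g′ → MissesCoset (t g′) y) gs →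
                  toggles gs cs S ∩ rightCoset R Q y ≡ S ∩ rightCoset R Q y
  toggles-∩-off []       []       S []              = refl
  toggles-∩-off (g ∷ gs) (c ∷ cs) S (avoid ∷ avoids) =
    trans (toggle-∩-off c (t g) (toggles gs cs S) avoid) (toggles-∩-off gs cs S avoids)

  toggles-balanced : ∀ {g} gs cs {S} → All (λ g′ → MissesCosets (t g′) g) gs →
                     Balanced S g → Balanced (toggles gs cs S) g
  toggles-balanced {g} gs cs {S} avoid bal = begin
    ∣ toggles gs cs S ∩ rightCoset R Q (a g) ∣  ≡⟨ cong ∣_∣ (toggles-∩-off gs cs S (All.map proj₁ avoid)) ⟩
    ∣ S ∩ rightCoset R Q (a g) ∣                ≡⟨ bal ⟩
    ∣ S ∩ rightCoset R Q (b g) ∣                ≡⟨ cong ∣_∣ (toggles-∩-off gs cs S (All.map proj₂ avoid)) ⟨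
    ∣ toggles gs cs S ∩ rightCoset R Q (b g) ∣  ∎
    where open ≡-Reasoning

  toggles-bits-determined : ∀ {gs} → Independent gs → ∀ {S S′} → InverseClosedᵇ S → InverseClosedᵇ S′ →
    All (Balanced S) gs → All (Balanced S′) gs → ∀ cs cs′ → toggles gs cs S ≡ toggles gs cs′ S′ → cs ≡ cs′
  toggles-bits-determined {[]} [] _ _ _ _ [] [] _ = refl
  toggles-bits-determined {g ∷ gs} (avoid ∷ indep) {S} {S′} closed closed′ (bal ∷ bals) (bal′ ∷ bals′)
                          (c ∷ cs) (c′ ∷ cs′) eq
    with refl ← toggle-bit-determined g {toggles gs cs S} {toggles gs cs′ S′} c c′
                  (toggles-inverseClosed gs cs closed) (toggles-inverseClosed gs cs′ closed′)
                  (toggles-balanced {g} gs cs {S} avoid bal) (toggles-balanced {g} gs cs′ {S′} avoid bal′) eq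
    = cong (c ∷_) (toggles-bits-determined indep closed closed′ bals bals′ cs cs′ (toggle-injective c (t g) eq))

  encode : (gs : List Gadget) → Subset n → Vec Bool (length gs) → Subset n
  encode gs S cs = toggles gs cs S ∩ representatives

  encode-injective : ∀ {gs} → Independent gs → ∀ {S S′} → InverseClosedᵇ S → InverseClosedᵇ S′ →
    All (Balanced S) gs → All (Balanced S′) gs → ∀ cs cs′ → encode gs S cs ≡ encode gs S′ cs′ → S ≡ S′ × cs ≡ cs′
  encode-injective {gs} indep {S} {S′} closed closed′ bals bals′ cs cs′ eq = S≡S′ , cs≡cs′
    where
    same-toggles : toggles gs cs S ≡ toggles gs cs′ S′
    same-toggles = inverseClosed-∩representatives-injective
      (toggles-inverseClosed gs cs closed) (toggles-inverseClosed gs cs′ closed′) eq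
    cs≡cs′ : cs ≡ cs′
    cs≡cs′ = toggles-bits-determined indep closed closed′ bals bals′ cs cs′ same-toggles
    S≡S′ : S ≡ S′
    S≡S′ = toggles-injective gs cs (trans same-toggles (cong (λ ds → toggles gs ds S′) (sym cs≡cs′)))

  evenly⇒balanced : ∀ {S} → (∀ x → IntersectsEvenly R Q S x) → ∀ g → Balanced S g
  evenly⇒balanced {S} evenly g = evenly (a g) (a g) (b g) (InDoubleCoset-refl (a g)) (b∈QaQ g)

  family-bound : ∀ {gs} → Independent gs → ∀ {Ls} → Unique Ls → All (InL R Q) Ls →
                 length Ls * 2 ^ length gs ≤ 2 ^ ∣ representatives ∣
  family-bound {gs} indep {Ls} uniq inL =
    subst₂ _≤_ (cong (length Ls *_) (trans (length-subsets (⊤ {length gs})) (cong (2 ^_) (∣⊤∣≡n (length gs)))))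
               (length-subsets representatives)
      (injectiveOn₂⇒length≤ (encode gs) uniq (subsets-unique (⊤ {length gs})) injective
        (λ {S} cs _ → ∈-subsets (Subset.p∩q⊆q (toggles gs cs S) representatives)))
    where
    closed : ∀ {S} → S ∈ Ls → InverseClosedᵇ S
    closed S∈ = inverseClosed⇒ᵇ (proj₁ (All.lookup inL S∈))
    balanced : ∀ {S} → S ∈ Ls → All (Balanced S) gs
    balanced {S} S∈ = All.universal (evenly⇒balanced {S} (proj₂ (All.lookup inL S∈))) gs
    injective : ∀ {S S′} cs cs′ → S ∈ Ls → S′ ∈ Ls → encode gs S cs ≡ encode gs S′ cs′ → S ≡ S′ × cs ≡ cs′
    injective cs cs′ S∈ S′∈ = encode-injective indep (closed S∈) (closed S′∈) (balanced S∈) (balanced S′∈) cs cs′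

module GadgetConstruction {n : ℕ} (R : FiniteGroup n) (Q : Subset n) (sg : IsSubgroup R Q) where
  open GroupLemmas R
  open IsSubgroup sg
  open Normaliser R Q sg
  open Cosets R Q sg
  open Gadgets R Q sg
  open DecMembership (Fin._≟_ {n}) using (_∈?_)

  cosetList : Fin n → List (Fin n)
  cosetList y = map (_∙ y) (elements Q)

  cosetAndInverses : Fin n → List (Fin n)
  cosetAndInverses y = cosetList y ++ map _⁻¹ (cosetList y)

  covered : List Gadget → List (Fin n)
  covered []       = []
  covered (g ∷ gs) = cosetAndInverses (a g) ++ cosetAndInverses (b g) ++ covered gs

  length-cosetAndInverses : ∀ y → length (cosetAndInverses y) ≡ ∣ Q ∣ + ∣ Q ∣
  length-cosetAndInverses y = trans (length-++ (cosetList y))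
    (cong₂ _+_ length-cosetList (trans (length-map _⁻¹ (cosetList y)) length-cosetList))
    where
    length-cosetList : length (cosetList y) ≡ ∣ Q ∣
    length-cosetList = trans (length-map (_∙ y) (elements Q)) (length-elements Q)

  length-covered : ∀ gs → length (covered gs) ≡ length gs * (4 * ∣ Q ∣)
  length-covered []       = refl
  length-covered (g ∷ gs) = begin
    length (cosetAndInverses (a g) ++ cosetAndInverses (b g) ++ covered gs)
      ≡⟨ length-++ (cosetAndInverses (a g)) ⟩
    length (cosetAndInverses (a g)) + length (cosetAndInverses (b g) ++ covered gs)
      ≡⟨ cong (length (cosetAndInverses (a g)) +_) (length-++ (cosetAndInverses (b g))) ⟩
    length (cosetAndInverses (a g)) + (length (cosetAndInverses (b g)) + length (covered gs))
      ≡⟨ cong₂ (λ u v → u + (v + length (covered gs))) (length-cosetAndInverses (a g)) (length-cosetAndInverses (b g)) ⟩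
    (∣ Q ∣ + ∣ Q ∣) + ((∣ Q ∣ + ∣ Q ∣) + length (covered gs))
      ≡⟨ cong (λ m → (∣ Q ∣ + ∣ Q ∣) + ((∣ Q ∣ + ∣ Q ∣) + m)) (length-covered gs) ⟩
    (∣ Q ∣ + ∣ Q ∣) + ((∣ Q ∣ + ∣ Q ∣) + length gs * (4 * ∣ Q ∣))
      ≡⟨ rearrange ∣ Q ∣ (length gs) ⟩
    suc (length gs) * (4 * ∣ Q ∣) ∎
    where
    open ≡-Reasoning
    rearrange : ∀ q k → (q + q) + ((q + q) + k * (4 * q)) ≡ suc k * (4 * q)
    rearrange = solve-∀

  ∉-cosetAndInverses⇒MissesCoset : ∀ {x y} → x ∉ cosetAndInverses y → MissesCoset x y
  ∉-cosetAndInverses⇒MissesCoset {x} {y} x∉ = x∉ ∘ ∈-++⁺ˡ ∘ ∈-cosetList , x∉ ∘ ∈-++⁺ʳ (cosetList y) ∘ ∈-inverses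
    where
    ∈-cosetList : ∀ {z} → InCoset y z → z ∈ cosetList y
    ∈-cosetList {z} z∈Qy = subst (_∈ cosetList y) (x∙y⁻¹∙y≡x z y) (∈-map⁺ (_∙ y) (∈-elements⁺ z∈Qy))
    ∈-inverses : InCoset y (x ⁻¹) → x ∈ map _⁻¹ (cosetList y)
    ∈-inverses x⁻¹∈Qy = subst (_∈ map _⁻¹ (cosetList y)) (⁻¹-involutive x) (∈-map⁺ _⁻¹ (∈-cosetList x⁻¹∈Qy))

  ∉-covered⇒MissesCosets : ∀ {x} gs → x ∉ covered gs → All (MissesCosets x) gs
  ∉-covered⇒MissesCosets []       _  = []
  ∉-covered⇒MissesCosets (g ∷ gs) x∉ =
    (∉-cosetAndInverses⇒MissesCoset (x∉ ∘ ∈-++⁺ˡ) ,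
     ∉-cosetAndInverses⇒MissesCoset (x∉ ∘ ∈-++⁺ʳ (cosetAndInverses (a g)) ∘ ∈-++⁺ˡ))
    ∷ ∉-covered⇒MissesCosets gs (x∉ ∘ ∈-++⁺ʳ (cosetAndInverses (a g)) ∘ ∈-++⁺ʳ (cosetAndInverses (b g)))

  MeetsDoubleCoset : Fin n → Gadget → Set
  MeetsDoubleCoset x g = InDoubleCoset R Q x (a g) ⊎ InDoubleCoset R Q x (b g)

  -- every coset meeting Q x Q lies inside it
  double-coset⇒MissesCosets : ∀ {x t g} → InDoubleCoset R Q x t → InDoubleCoset R Q x (t ⁻¹) →
                              ¬ MeetsDoubleCoset x g → MissesCosets t g
  double-coset⇒MissesCosets t∈QxQ t⁻¹∈QxQ ¬meets =
    (¬meets ∘ inj₁ ∘ InDoubleCoset-coset t∈QxQ , ¬meets ∘ inj₁ ∘ InDoubleCoset-coset t⁻¹∈QxQ) ,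
    (¬meets ∘ inj₂ ∘ InDoubleCoset-coset t∈QxQ , ¬meets ∘ inj₂ ∘ InDoubleCoset-coset t⁻¹∈QxQ)

  gadget-at : ∀ {x y} → InDoubleCoset R Q x y → MissesCoset x y → Gadget
  gadget-at {x} {y} y∈QxQ x∉Qy = record
    { a = x ; b = y ; t = x ; t∈Qa = x∈Qx x ; avoids = x∉Qy ; b∈QaQ = y∈QxQ }

  -- the case x⁻¹ ∈ Q x h, where x itself cannot serve as t
  gadget-h⁻¹x : ∀ {x h} → h ∈ₛ Q → conj x h ∉ₛ Q → InCoset (x ∙ h) (x ⁻¹) →
    Σ Gadget λ g → InDoubleCoset R Q x (t g) × InDoubleCoset R Q x (t g ⁻¹)
  gadget-h⁻¹x {x} {h} h∈Q xhx⁻¹∉Q x⁻¹∈Qxh = record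
      { a = x ; b = x ∙ h ; t = h ⁻¹ ∙ x
      ; t∈Qa = subst (_∈ₛ Q) (sym (x∙y∙y⁻¹≡x (h ⁻¹) x)) (⁻¹-closed h∈Q)
      ; avoids = t∉Qxh , t⁻¹∉Qxh
      ; b∈QaQ = xh∈QxQ h∈Q }
    , t∈QxQ , t⁻¹∈QxQ
    where
    t∉Qxh : ¬ InCoset (x ∙ h) (h ⁻¹ ∙ x)
    t∉Qxh t∈Qxh =
      x∉Qxh xhx⁻¹∉Q (∈Q-cancelˡ (⁻¹-closed h∈Q) (subst (_∈ₛ Q) (assoc (h ⁻¹) x ((x ∙ h) ⁻¹)) t∈Qxh))
    t⁻¹∉Qxh : ¬ InCoset (x ∙ h) ((h ⁻¹ ∙ x) ⁻¹)
    t⁻¹∉Qxh t⁻¹∈Qxh = conj⁻¹∉Q xhx⁻¹∉Q (subst (_∈ₛ Q) ([x⁻¹∙x⁻¹]⁻¹∙[x⁻¹∙[x∙h]⁻¹]≡conj[x,h⁻¹] x h)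
      (∙-closed (⁻¹-closed (subst (_∈ₛ Q) ([h⁻¹∙x]⁻¹∙[x∙h]⁻¹≡x⁻¹∙x⁻¹ x h) t⁻¹∈Qxh)) x⁻¹∈Qxh))
    t∈QxQ : InDoubleCoset R Q x (h ⁻¹ ∙ x)
    t∈QxQ = h ⁻¹ , ε , ⁻¹-closed h∈Q , ε∈ , sym (identityʳ _)
    t⁻¹∈QxQ : InDoubleCoset R Q x ((h ⁻¹ ∙ x) ⁻¹)
    t⁻¹∈QxQ = x ⁻¹ ∙ (x ∙ h) ⁻¹ , h ∙ h , x⁻¹∈Qxh , ∙-closed h∈Q h∈Q , [h⁻¹∙x]⁻¹≡x⁻¹∙[x∙h]⁻¹∙x∙[h∙h] x h

  new-gadget : ∀ gs {x} → ¬ Normalises x → x ∉ covered gs → Σ Gadget λ g → All (MissesCosets (t g)) gs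
  new-gadget gs {x} ¬nx x∉ with Any.any? (λ g → InDoubleCoset? x (a g) ⊎-dec InDoubleCoset? x (b g)) gs
  ... | yes meets with All.lookupAny (∉-covered⇒MissesCosets gs x∉) meets
  ...   | (x∉Qa , _) , inj₁ a∈QxQ = gadget-at a∈QxQ x∉Qa , ∉-covered⇒MissesCosets gs x∉
  ...   | (_ , x∉Qb) , inj₂ b∈QxQ = gadget-at b∈QxQ x∉Qb , ∉-covered⇒MissesCosets gs x∉
  new-gadget gs {x} ¬nx x∉ | no ¬meets with ¬normalises⇒witness ¬nx
  ... | h , h∈Q , xhx⁻¹∉Q with inCoset? (x ∙ h) (x ⁻¹)
  ...   | no  x⁻¹∉Qxh = gadget-at (xh∈QxQ h∈Q) (x∉Qxh xhx⁻¹∉Q , x⁻¹∉Qxh) , ∉-covered⇒MissesCosets gs x∉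
  ...   | yes x⁻¹∈Qxh with gadget-h⁻¹x h∈Q xhx⁻¹∉Q x⁻¹∈Qxh
  ...     | g , t∈QxQ , t⁻¹∈QxQ =
    g , All.map (λ {g′} → double-coset⇒MissesCosets {g = g′} t∈QxQ t⁻¹∈QxQ)
                (All.¬Any⇒All¬ {P = MeetsDoubleCoset x} gs ¬meets)

  uncovered-element : ∀ {g₀} → ¬ Normalises g₀ → ∀ gs → ¬ n ≤ length gs * (8 * ∣ Q ∣) →
                      Σ (Fin n) λ x → ¬ Normalises x × x ∉ covered gs
  uncovered-element {g₀} ¬ng₀ gs short with Fin.all? {n = n} (λ x → x ∈? normaliser-list ++ covered gs)
  ... | no ¬all = let x , x∉ = Fin.¬∀⟶∃¬ n (_∈ normaliser-list ++ covered gs) (_∈? normaliser-list ++ covered gs) ¬all in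
    x , x∉ ∘ ∈-++⁺ˡ ∘ ∈-normaliser-list⁺ , x∉ ∘ ∈-++⁺ʳ normaliser-list
  ... | yes all = ⊥-elim (short (subst (n ≤_) (double (length gs) ∣ Q ∣)
                   (m≤a+b∧a+a≤m⇒m≤b+b {a = length normaliser-list} n≤N+covered (¬normalises⇒normaliser-half ¬ng₀))))
    where
    double : ∀ k q → k * (4 * q) + k * (4 * q) ≡ k * (8 * q)
    double = solve-∀
    n≤N+covered : n ≤ length normaliser-list + length gs * (4 * ∣ Q ∣)
    n≤N+covered = subst (n ≤_) (trans (length-++ normaliser-list) (cong (length normaliser-list +_) (length-covered gs)))
      (covers⇒n≤length {xs = normaliser-list ++ covered gs} all)

  independent-snoc : ∀ {gs g} → Independent gs → All (MissesCosets (t g)) gs → Independent (gs ++ g ∷ [])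
  independent-snoc indep misses = AllPairs.++⁺ indep ([] ∷ []) (All.map (_∷ []) misses)

  many-gadgets : ∀ {g₀} → ¬ Normalises g₀ → Σ (List Gadget) λ gs → Independent gs × n ≤ length gs * (8 * ∣ Q ∣)
  many-gadgets {g₀} ¬ng₀ = extend n [] [] (ℕ.≤-reflexive (sym (+-identityʳ n)))
    where
    instance
      _ = ℕ.m*n≢0 8 ∣ Q ∣ {{_}} {{subgroup-nonZero R sg}}
    extend : ∀ fuel gs → Independent gs → n ≤ fuel + length gs →
             Σ (List Gadget) λ gs → Independent gs × n ≤ length gs * (8 * ∣ Q ∣)
    extend zero gs indep n≤k = gs , indep , ℕ.≤-trans n≤k (ℕ.m≤m*n (length gs) (8 * ∣ Q ∣))
    extend (suc fuel) gs indep n≤fuel+k with n ℕ.≤? length gs * (8 * ∣ Q ∣)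
    ... | yes done = gs , indep , done
    ... | no short with x , ¬nx , x∉ ← uncovered-element ¬ng₀ gs short
                   with g , misses ← new-gadget gs ¬nx x∉
      = extend fuel (gs ++ g ∷ []) (independent-snoc indep misses) (subst (n ≤_) (begin
          suc fuel + length gs          ≡⟨ ℕ.+-suc fuel (length gs) ⟨
          fuel + suc (length gs)        ≡⟨ cong (fuel +_) (ℕ.+-comm 1 (length gs)) ⟩
          fuel + (length gs + 1)        ≡⟨ cong (fuel +_) (length-++ gs) ⟨
          fuel + length (gs ++ g ∷ [])  ∎) n≤fuel+k)
      where open ≡-Reasoning

  index≤ : ∀ k → n ≤ k * (8 * ∣ Q ∣) → index R Q sg ≤ k * 8
  index≤ k n≤k8q = ℕ.≤-trans (DivMod./-monoˡ-≤ ∣ Q ∣ n≤k8q)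
    (ℕ.≤-reflexive (trans (cong (_/ ∣ Q ∣) (sym (ℕ.*-assoc k 8 ∣ Q ∣))) (DivMod.m*n/n≡m (k * 8) ∣ Q ∣)))
    where instance _ = subgroup-nonZero R sg

proposition3p1 : ∀ {n : ℕ} (R : FiniteGroup n) (Q : Subset n)
    → (sg : IsSubgroup R Q) → ¬ IsNormal R Q
    → (Ls : List (Subset n)) → Unique Ls → All (InL R Q) Ls
    → length Ls ^ 8 * 2 ^ index R Q sg ≤ 2 ^ (4 * (n + ∣ involutionsAndId R ∣))
proposition3p1 R Q sg ¬normal Ls uniq inL =
  let _ , ¬normalises            = ¬normal⇒¬normalises ¬normal
      gs , independent , n≤8k∣Q∣ = many-gadgets ¬normalises
  in power-bound (length Ls) (length gs) {p = ∣ representatives ∣} (index≤ (length gs) n≤8k∣Q∣)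
                 (family-bound independent uniq inL)
                 ∣representatives∣+∣representatives∣≤n+∣involutionsAndId∣
  where
  open Normaliser R Q sg using (¬normal⇒¬normalises)
  open InversionRepresentatives R using (representatives; ∣representatives∣+∣representatives∣≤n+∣involutionsAndId∣)
  open Gadgets R Q sg using (family-bound)
  open GadgetConstruction R Q sg using (many-gadgets; index≤)
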